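{- Let $\mathbf A=\langle A,+,',1\rangle$ be a 0-commutative orthogroupoid and $e$ a central element of $\mathbf A$. Let $x\wedge y:=q(x,y,0)=(x+0)\cdot(x'+y)$, and let $\mathbf A_e$ be the algebra with universe $A_e=\{e\wedge b:b\in A\}$ and operations $x+_e y=e\wedge(x+y)$, $x'^{_e}=e\wedge x'$ and constant $e\wedge 1$. Let $[0,e]=\{x\in A:(x,e)\in R\text{ and }x+e=e+x\}=\{x\in A: x+e=e+x=e\}$, where $(a,b)\in R$ iff $a+b=b$. Then $A_e=[0,e]$, $e\wedge 1=e$, and for all $x,y\in[0,e]$ we have $x+_e y=x+y$ and $x'^{_e}=e\cdot x'$; that is, $\mathbf A_e$ is the algebra $\langle[0,e],+,{}^{e},e\rangle$ with $x^{e}:=e\cdot x'$.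
   Context: An orthogroupoid is an algebra $\langle A,+,',1\rangle$ of type $(2,1,0)$, with $0:=1'$, satisfying: (a) $x''\approx x$; (b) $0+x\approx x$ and $x+1\approx 1$; (c) $x+x'\approx 1$; (d) for all $x,z$: if $x+z=z$ and $x'+z=z$ then $z=1$; (e) $(((z+y)'+(z+x))'+(z+y)')+z'\approx z'$; (f) $x+(x+y)\approx x+y$ and $y+(x+y)\approx x+y$. It is 0-commutative if it satisfies $x+0\approx 0+x$. Define $x\cdot y:=(x'+y')'$ and $q(x,y,z)=(x+z)\cdot(x'+y)$. An element $e\in A$ is central if the principal congruences $\theta(e,0)$ and $\theta(e,1)$ form a pair of factor congruences of $\mathbf A$ (their intersection is the identity relation and their composition is $A\times A$). -}

module Defs where

open import Level using (Level; suc; _⊔_)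
open import Data.Product using (Σ; ∃; _×_; _,_)
open import Relation.Binary.PropositionalEquality using (_≡_)

record Orthogroupoid (a : Level) : Set (suc a) where
  infixl 6 _⊕_
  field
    Carrier : Set a
    _⊕_     : Carrier → Carrier → Carrier
    _′      : Carrier → Carrier
    𝟙       : Carrier

  𝟘 : Carrier
  𝟘 = 𝟙 ′

  field
    ax-a  : ∀ x → (x ′) ′ ≡ x
    ax-b₁ : ∀ x → 𝟘 ⊕ x ≡ x
    ax-b₂ : ∀ x → x ⊕ 𝟙 ≡ 𝟙
    ax-c  : ∀ x → x ⊕ (x ′) ≡ 𝟙
    ax-d  : ∀ x z → x ⊕ z ≡ z → (x ′) ⊕ z ≡ z → z ≡ 𝟙
    ax-e  : ∀ x y z →
            ((((z ⊕ y) ′) ⊕ (z ⊕ x)) ′ ⊕ ((z ⊕ y) ′)) ⊕ (z ′) ≡ z ′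
    ax-f₁ : ∀ x y → x ⊕ (x ⊕ y) ≡ x ⊕ y
    ax-f₂ : ∀ x y → y ⊕ (x ⊕ y) ≡ x ⊕ y

module OG {a : Level} (A : Orthogroupoid a) where
  open Orthogroupoid A public

  _·_ : Carrier → Carrier → Carrier
  x · y = ((x ′) ⊕ (y ′)) ′

  q : Carrier → Carrier → Carrier → Carrier
  q x y z = (x ⊕ z) · ((x ′) ⊕ y)

  _∧_ : Carrier → Carrier → Carrier
  x ∧ y = q x y 𝟘

  data θ (u v : Carrier) : Carrier → Carrier → Set a where
    gen   : θ u v u v
    refl′ : ∀ {x} → θ u v x x
    sym′  : ∀ {x y} → θ u v x y → θ u v y x
    trans′ : ∀ {x y z} → θ u v x y → θ u v y z → θ u v x z
    cong-⊕ : ∀ {x x₁ y y₁} → θ u v x x₁ → θ u v y y₁ → θ u v (x ⊕ y) (x₁ ⊕ y₁)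
    cong-′ : ∀ {x y} → θ u v x y → θ u v (x ′) (y ′)

  -- e is central: θ(e,0), θ(e,1) form a pair of factor congruences
  -- (intersection is the identity, relational composition is A × A).
  Central : Carrier → Set a
  Central e =
    (∀ x y → θ e 𝟘 x y → θ e 𝟙 x y → x ≡ y) ×
    (∀ x y → ∃ λ z → θ e 𝟘 x z × θ e 𝟙 z y)

  R : Carrier → Carrier → Set a
  R x y = x ⊕ y ≡ y

  Interval : Carrier → Carrier → Set a
  Interval e x = R x e × (x ⊕ e ≡ e ⊕ x)

  Ae : Carrier → Carrier → Set a
  Ae e x = ∃ λ b → x ≡ e ∧ b

  _⊕[_]_ : Carrier → Carrier → Carrier → Carrier
  x ⊕[ e ] y = e ∧ (x ⊕ y)

  compl[_] : Carrier → Carrier → Carrier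
  compl[ e ] x = e ∧ (x ′)

  one[_] : Carrier → Carrier
  one[ e ] = e ∧ 𝟙

ZeroCommutative : {a : Level} → Orthogroupoid a → Set a
ZeroCommutative A = ∀ x → x ⊕ 𝟘 ≡ 𝟘 ⊕ x
  where open Orthogroupoid A

-- Since θ(e,0) ∩ θ(e,1) is the identity, an equation holds as soon as it holds
-- modulo θ(e,0), where e collapses to 0, and modulo θ(e,1), where e collapses
-- to 1. Moreover e + x = e forces x ≡ 0 modulo θ(e,0), because then
-- x = 0 + x ≡ e + x = e ≡ 0. In both quotients every identity needed below
-- reduces to a law of 0 and 1, e.g. e ∧ b becomes 0 ∧ b = 0 resp. 1 ∧ b = b.
module Submission where

open import Defs
open import Level using (Level)
open import Data.Product using (_×_; _,_; proj₁)
open import Function.Bundles using (_⇔_; mk⇔)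
open import Relation.Binary.PropositionalEquality
  using (_≡_; refl; sym; trans; cong; subst)

module Laws {a : Level} (A : Orthogroupoid a) where
  open OG A

  ⊕-zeroˡ : ∀ x → 𝟙 ⊕ x ≡ 𝟙
  ⊕-zeroˡ x = ax-d 𝟙 (𝟙 ⊕ x) (ax-f₁ 𝟙 x) (ax-b₁ (𝟙 ⊕ x))

  𝟘′≡𝟙 : 𝟘 ′ ≡ 𝟙
  𝟘′≡𝟙 = ax-a 𝟙

  ·-zeroˡ : ∀ x → 𝟘 · x ≡ 𝟘
  ·-zeroˡ x = cong _′ (trans (cong (_⊕ x ′) 𝟘′≡𝟙) (⊕-zeroˡ (x ′)))

  ·-identityˡ : ∀ x → 𝟙 · x ≡ x
  ·-identityˡ x = trans (cong _′ (ax-b₁ (x ′))) (ax-a x)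

  ∧-zeroˡ : ∀ b → 𝟘 ∧ b ≡ 𝟘
  ∧-zeroˡ b = trans (cong (λ t → t · (𝟘 ′ ⊕ b)) (ax-b₁ 𝟘))
                    (·-zeroˡ (𝟘 ′ ⊕ b))

  ∧-identityˡ : ∀ b → 𝟙 ∧ b ≡ b
  ∧-identityˡ b = trans (cong (_· (𝟘 ⊕ b)) (⊕-zeroˡ 𝟘))
                        (trans (·-identityˡ (𝟘 ⊕ b)) (ax-b₁ b))

  ≡⇒θ : ∀ {u v s t} → s ≡ t → θ u v s t
  ≡⇒θ refl = refl′

  θ-by : ∀ {u v s s′ t t′} → θ u v s s′ → s′ ≡ t′ → θ u v t t′ → θ u v s t
  θ-by s~s′ s′≡t′ t~t′ = trans′ s~s′ (trans′ (≡⇒θ s′≡t′) (sym′ t~t′))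

  θ-cong-· : ∀ {u v p p₁ r r₁} → θ u v p p₁ → θ u v r r₁ → θ u v (p · r) (p₁ · r₁)
  θ-cong-· p~p₁ r~r₁ = cong-′ (cong-⊕ (cong-′ p~p₁) (cong-′ r~r₁))

  θ-cong-∧ : ∀ {u v p p₁ r r₁} → θ u v p p₁ → θ u v r r₁ → θ u v (p ∧ r) (p₁ ∧ r₁)
  θ-cong-∧ p~p₁ r~r₁ = θ-cong-· (cong-⊕ p~p₁ refl′) (cong-⊕ (cong-′ p~p₁) r~r₁)

  module CentralElement (e : Carrier) (central : Central e) where

    central-sep : ∀ {s t} → θ e 𝟘 s t → θ e 𝟙 s t → s ≡ t
    central-sep = proj₁ central _ _

    below⇒θ₀ : ∀ {x} → e ⊕ x ≡ e → θ e 𝟘 x 𝟘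
    below⇒θ₀ {x} e⊕x≡e =
      θ-by (trans′ (≡⇒θ (sym (ax-b₁ x))) (cong-⊕ (sym′ gen) refl′)) e⊕x≡e (sym′ gen)

    ∧-identityʳ : e ∧ 𝟙 ≡ e
    ∧-identityʳ = central-sep
      (θ-by (θ-cong-∧ gen refl′) (∧-zeroˡ 𝟙) gen)
      (θ-by (θ-cong-∧ gen refl′) (∧-identityˡ 𝟙) gen)

    ∧⊕e≡e : ∀ b → (e ∧ b) ⊕ e ≡ e
    ∧⊕e≡e b = central-sep
      (θ-by (cong-⊕ (θ-cong-∧ gen refl′) gen)
            (trans (cong (_⊕ 𝟘) (∧-zeroˡ b)) (ax-b₁ 𝟘)) gen)
      (θ-by (cong-⊕ (θ-cong-∧ gen refl′) gen) (ax-b₂ (𝟙 ∧ b)) gen)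

    e⊕∧≡e : ∀ b → e ⊕ (e ∧ b) ≡ e
    e⊕∧≡e b = central-sep
      (θ-by (cong-⊕ gen (θ-cong-∧ gen refl′))
            (trans (ax-b₁ (𝟘 ∧ b)) (∧-zeroˡ b)) gen)
      (θ-by (cong-⊕ gen (θ-cong-∧ gen refl′)) (⊕-zeroˡ (𝟙 ∧ b)) gen)

    ∧-fixes-below : ∀ {x} → e ⊕ x ≡ e → e ∧ x ≡ x
    ∧-fixes-below e⊕x≡e = central-sep
      (θ-by (θ-cong-∧ gen (below⇒θ₀ e⊕x≡e)) (∧-zeroˡ 𝟘) (below⇒θ₀ e⊕x≡e))
      (θ-by (θ-cong-∧ gen refl′) (∧-identityˡ _) refl′)

    ⊕-closed-below : ∀ {x y} → e ⊕ x ≡ e → e ⊕ y ≡ e → e ⊕ (x ⊕ y) ≡ e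
    ⊕-closed-below e⊕x≡e e⊕y≡e = central-sep
      (θ-by (cong-⊕ gen (cong-⊕ (below⇒θ₀ e⊕x≡e) (below⇒θ₀ e⊕y≡e)))
            (trans (ax-b₁ (𝟘 ⊕ 𝟘)) (ax-b₁ 𝟘)) gen)
      (θ-by (cong-⊕ gen refl′) (⊕-zeroˡ _) gen)

    ∧-′-below : ∀ {x} → e ⊕ x ≡ e → e ∧ (x ′) ≡ e · (x ′)
    ∧-′-below e⊕x≡e = central-sep
      (θ-by (θ-cong-∧ gen (cong-′ (below⇒θ₀ e⊕x≡e)))
            (trans (∧-zeroˡ (𝟘 ′)) (sym (·-zeroˡ (𝟘 ′))))
            (θ-cong-· gen (cong-′ (below⇒θ₀ e⊕x≡e))))
      (θ-by (θ-cong-∧ gen refl′)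
            (trans (∧-identityˡ _) (sym (·-identityˡ _)))
            (θ-cong-· gen refl′))

    Interval⇒below : ∀ {x} → Interval e x → e ⊕ x ≡ e
    Interval⇒below (x⊕e≡e , comm) = trans (sym comm) x⊕e≡e

    Interval⇔below : ∀ x → Interval e x ⇔ ((x ⊕ e ≡ e) × (e ⊕ x ≡ e))
    Interval⇔below x = mk⇔ (λ x∈@(x⊕e≡e , _) → x⊕e≡e , Interval⇒below x∈)
                           (λ { (x⊕e≡e , e⊕x≡e) → x⊕e≡e , trans x⊕e≡e (sym e⊕x≡e) })

    Ae⇔Interval : ∀ x → Ae e x ⇔ Interval e x
    Ae⇔Interval x = mk⇔
      (λ { (b , x≡e∧b) → subst (Interval e) (sym x≡e∧b)
                                (∧⊕e≡e b , trans (∧⊕e≡e b) (sym (e⊕∧≡e b))) })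
      (λ x∈ → x , sym (∧-fixes-below (Interval⇒below x∈)))

lemma3p7 : {a : Level} (A : Orthogroupoid a) → ZeroCommutative A →
    let open OG A in
    (e : Carrier) → Central e →
      (∀ x → Ae e x ⇔ Interval e x) ×
      (∀ x → Interval e x ⇔ ((x ⊕ e ≡ e) × (e ⊕ x ≡ e))) ×
      (one[ e ] ≡ e) ×
      (∀ x y → Interval e x → Interval e y →
        (x ⊕[ e ] y ≡ x ⊕ y) × (compl[ e ] x ≡ e · (x ′)))
lemma3p7 A _ e central =
    Ae⇔Interval
  , Interval⇔below
  , ∧-identityʳ
  , λ x y x∈ y∈ →
      ∧-fixes-below (⊕-closed-below (Interval⇒below x∈) (Interval⇒below y∈))
    , ∧-′-below (Interval⇒below x∈)
  where open Laws A; open CentralElement e central
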